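{- Let $G$ be a finite simple graph without isolated vertices that has an induced cycle of order six such that five of its vertices have degree two in $G$ and the sixth vertex is a stem of $G$. Then $G\notin\Omega$.
   Context: A leaf is a vertex of degree one; a stem is a vertex having at least one leaf as a neighbor. A star is a graph isomorphic to $K_{1,n}$ for some $n\ge 1$. A star-factor of $G$ is a spanning subgraph each of whose connected components is a star. An edge-weighting of $G$ is a function $w:E(G)\to\mathbb{N}^+$ (positive integers), and the weight of a subgraph $H$ is $w(H)=\sum_{e\in E(H)}w(e)$. $\Omega$ denotes the family of all graphs $G$ for which there exists an edge-weighting $w$ of $G$ such that all star-factors of $G$ have the same weight under $w$. -}

module Defs where

open import Data.Nat using (ℕ; zero; suc; _+_; _<_; _<?_)
open import Data.Fin using (Fin; zero; suc; toℕ; _≟_)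
open import Data.Bool using (Bool; true; false; if_then_else_; _∨_; _∧_)
open import Data.Product using (Σ; ∃; ∃-syntax; _×_; _,_)
open import Relation.Binary.PropositionalEquality using (_≡_; _≢_)
open import Relation.Nullary using (¬_; does)
open import Function.Definitions using (Injective)
open import Data.Sum using (_⊎_)

sumFin : ∀ {n} → (Fin n → ℕ) → ℕ
sumFin {zero} f = 0
sumFin {suc n} f = f zero + sumFin (λ i → f (suc i))

record Graph : Set where
  field
    n     : ℕ
    adj   : Fin n → Fin n → Bool
    sym   : ∀ u v → adj u v ≡ adj v u
    irrefl : ∀ v → adj v v ≡ false
open Graph public

deg : (G : Graph) → Fin (n G) → ℕ
deg G v = sumFin (λ u → if adj G v u then 1 else 0)

NoIsolated : Graph → Set
NoIsolated G = ∀ v → ∃[ u ] adj G v u ≡ true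

IsLeaf : (G : Graph) → Fin (n G) → Set
IsLeaf G v = deg G v ≡ 1

IsStem : (G : Graph) → Fin (n G) → Set
IsStem G v = ∃[ u ] (adj G v u ≡ true × IsLeaf G u)

record SpanningSubgraph (G : Graph) : Set where
  field
    E     : Fin (n G) → Fin (n G) → Bool
    Esym  : ∀ u v → E u v ≡ E v u
    E⊆G   : ∀ u v → E u v ≡ true → adj G u v ≡ true
open SpanningSubgraph public

data Reach {G : Graph} (F : SpanningSubgraph G) : Fin (n G) → Fin (n G) → Set where
  here : ∀ {u} → Reach F u u
  step : ∀ {u v w} → E F u v ≡ true → Reach F v w → Reach F u w

-- The connected component of F containing v is a star K_{1,m} (m ≥ 1):
-- it has a centre c such that every edge of F inside the component is
-- incident with c, and the component has at least two vertices.
ComponentIsStar : {G : Graph} → SpanningSubgraph G → Fin (n G) → Set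
ComponentIsStar {G} F v =
  Σ (Fin (n G)) λ c →
    Reach F v c ×
    (∃[ u ] (Reach F v u × u ≢ c)) ×
    (∀ x y → Reach F v x → E F x y ≡ true → (x ≡ c) ⊎ (y ≡ c))

IsStarFactor : {G : Graph} → SpanningSubgraph G → Set
IsStarFactor F = ∀ v → ComponentIsStar F v

-- Edge-weightings w : E(G) → ℕ⁺, given as a symmetric function on pairs
-- that is positive on every edge (values on non-edges are irrelevant).
record EdgeWeighting (G : Graph) : Set where
  field
    w    : Fin (n G) → Fin (n G) → ℕ
    wsym : ∀ u v → w u v ≡ w v u
    wpos : ∀ u v → adj G u v ≡ true → 0 < w u v
open EdgeWeighting public

weight : {G : Graph} → EdgeWeighting G → SpanningSubgraph G → ℕ
weight ω F = sumFin λ u → sumFin λ v →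
  if E F u v ∧ does (toℕ u <? toℕ v) then w ω u v else 0

InΩ : Graph → Set
InΩ G = ∃[ ω ] (∀ (F₁ F₂ : SpanningSubgraph G) → IsStarFactor F₁ → IsStarFactor F₂ →
                 weight {G} ω F₁ ≡ weight ω F₂)

next6 : Fin 6 → Fin 6
next6 zero = suc zero
next6 (suc zero) = suc (suc zero)
next6 (suc (suc zero)) = suc (suc (suc zero))
next6 (suc (suc (suc zero))) = suc (suc (suc (suc zero)))
next6 (suc (suc (suc (suc zero)))) = suc (suc (suc (suc (suc zero))))
next6 (suc (suc (suc (suc (suc zero))))) = zero

cycAdj6 : Fin 6 → Fin 6 → Bool
cycAdj6 i j = does (j ≟ next6 i) ∨ does (i ≟ next6 j)

IsInducedC6 : (G : Graph) → (Fin 6 → Fin (n G)) → Set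
IsInducedC6 G c = Injective _≡_ _≡_ c × (∀ i j → adj G (c i) (c j) ≡ cycAdj6 i j)

module Submission where

-- The five degree-two vertices c₁, …, c₅ of the cycle only see the cycle, so the rest of the
-- graph has no isolated vertex (c₀ keeps its leaf) and thus a star factor in which c₀ is a
-- centre.  It extends to a star factor of G by any grouping of c₁, …, c₅ into stars of the
-- cycle in which c₀ may act as a centre, and the weight of the extension is a common part plus
-- the weights of the cycle edges used.  Two pairs of groupings force w(c₄c₅) = w(c₄c₃) + w(c₅c₀)
-- and w(c₅c₀) = w(c₅c₄), hence w(c₃c₄) = 0, contradicting positivity.

open import Defs hiding (sym)

open import Data.Bool using (Bool; true; false; if_then_else_; _∧_) renaming (_≟_ to _≟ᵇ_)
open import Data.Empty using (⊥-elim)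
open import Data.Fin using (Fin; zero; suc; toℕ; _≟_)
open import Data.Fin.Patterns using (0F; 1F; 2F; 3F; 4F; 5F)
open import Data.Fin.Properties using (any?; all?; toℕ-injective; suc-injective)
open import Data.List using (List; []; _∷_; length; allFin)
open import Data.List.Membership.Propositional using (_∈_)
open import Data.List.Membership.Propositional.Properties using (∈-allFin)
open import Data.List.Relation.Unary.All using (All; []; _∷_)
import Data.List.Relation.Unary.All as All
open import Data.List.Relation.Unary.Any using (here; there)
open import Data.List.Relation.Unary.Unique.Propositional using (Unique; []; _∷_)
open import Data.Nat using (ℕ; zero; suc; _+_; _≤_; _<_; _<?_; z≤n; s≤s)
open import Data.Nat.Properties
  using (+-identityʳ; +-mono-≤; <-irrefl; <-cmp; +-cancelˡ-≡; +-cancelʳ-≡; <⇒≢; +-commutativeSemigroup)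
open import Algebra.Properties.CommutativeSemigroup +-commutativeSemigroup using (interchange)
open import Data.Product using (Σ; ∃-syntax; _×_; _,_; proj₁; proj₂)
open import Data.Sum using (_⊎_; inj₁; inj₂)
open import Data.Unit using (⊤; tt)
open import Data.Vec using (lookup; _∷_; [])
open import Data.Vec.Functional using (updateAt)
open import Data.Vec.Functional.Properties using (updateAt-updates; updateAt-minimal)
open import Function using (_∘_; const)
open import Function.Bundles using (mk⇔)
open import Function.Definitions using (Injective)
open import Relation.Binary.Definitions using (tri<; tri≈; tri>)
open import Relation.Binary.PropositionalEquality
open import Relation.Nullary using (¬_; Dec; yes; no; does)
open import Relation.Nullary.Decidable
  using (dec-true; dec-false; does-⇔; ¬?; _×-dec_; _⊎-dec_; _→-dec_; map′; from-yes)

does-true : {P : Set} (P? : Dec P) → does P? ≡ true → P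
does-true (yes p) _ = p

if-⊎-dec : {A B : Set} (a? : Dec A) (b? : Dec B) → ¬ (A × B) → ∀ x →
           (if does (a? ⊎-dec b?) then x else 0) ≡ (if does a? then x else 0) + (if does b? then x else 0)
if-⊎-dec (yes a) (yes b) ¬ab x = ⊥-elim (¬ab (a , b))
if-⊎-dec (yes a) (no _)  ¬ab x = sym (+-identityʳ x)
if-⊎-dec (no _)  b?      ¬ab x = refl

if-yes : {A : Set} (a? : Dec A) → A → ∀ x → (if does a? then x else 0) ≡ x
if-yes a? a x = cong (λ b → if b then x else 0) (dec-true a? a)

if-no : {A : Set} (a? : Dec A) → ¬ A → ∀ x → (if does a? then x else 0) ≡ 0
if-no a? ¬a x = cong (λ b → if b then x else 0) (dec-false a? ¬a)

if-no-cong : {A : Set} (a? : Dec A) {x y : ℕ} → (¬ A → x ≡ y) →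
             (if does a? then 0 else x) ≡ (if does a? then 0 else y)
if-no-cong (yes _) _   = refl
if-no-cong (no ¬a) x≡y = x≡y ¬a

sumFin-cong : ∀ {m} {f g : Fin m → ℕ} → (∀ i → f i ≡ g i) → sumFin f ≡ sumFin g
sumFin-cong {zero}  f≗g = refl
sumFin-cong {suc m} f≗g = cong₂ _+_ (f≗g zero) (sumFin-cong (f≗g ∘ suc))

sumFin-mono : ∀ {m} {f g : Fin m → ℕ} → (∀ i → f i ≤ g i) → sumFin f ≤ sumFin g
sumFin-mono {zero}  f≤g = z≤n
sumFin-mono {suc m} f≤g = +-mono-≤ (f≤g zero) (sumFin-mono (f≤g ∘ suc))

sumFin-+ : ∀ {m} (f g : Fin m → ℕ) → sumFin (λ i → f i + g i) ≡ sumFin f + sumFin g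
sumFin-+ {zero}  f g = refl
sumFin-+ {suc m} f g =
  trans (cong (f zero + g zero +_) (sumFin-+ (f ∘ suc) (g ∘ suc)))
        (interchange (f zero) (g zero) (sumFin (f ∘ suc)) (sumFin (g ∘ suc)))

sumFin-zero : ∀ {m} {f : Fin m → ℕ} → (∀ i → f i ≡ 0) → sumFin f ≡ 0
sumFin-zero {zero}  f≗0 = refl
sumFin-zero {suc m} f≗0 = cong₂ _+_ (f≗0 zero) (sumFin-zero (f≗0 ∘ suc))

sumFin-single : ∀ {m} {f : Fin m → ℕ} i → (∀ j → j ≢ i → f j ≡ 0) → sumFin f ≡ f i
sumFin-single {suc m} {f} zero    f≗0 =
  trans (cong (f zero +_) (sumFin-zero (λ j → f≗0 (suc j) λ ()))) (+-identityʳ (f zero))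
sumFin-single {suc m} {f} (suc i) f≗0 =
  cong₂ _+_ (f≗0 zero λ ()) (sumFin-single i (λ j j≢i → f≗0 (suc j) (j≢i ∘ suc-injective)))

sumFin-comm : ∀ {m k} (f : Fin m → Fin k → ℕ) →
              sumFin (λ i → sumFin (f i)) ≡ sumFin (λ j → sumFin (λ i → f i j))
sumFin-comm {zero} {k} f = sym (sumFin-zero {k} (λ _ → refl))
sumFin-comm {suc m} f =
  trans (cong (sumFin (f zero) +_) (sumFin-comm (f ∘ suc)))
        (sym (sumFin-+ (f zero) (λ j → sumFin (λ i → f (suc i) j))))

indicator : ∀ {m} → Fin m → Fin m → ℕ
indicator a x = if does (x ≟ a) then 1 else 0

sumFin-indicator : ∀ {m} (a : Fin m) → sumFin (indicator a) ≡ 1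
sumFin-indicator a = trans (sumFin-single a λ x x≢a → if-no (x ≟ a) x≢a 1) (if-yes (a ≟ a) refl 1)

occurrences : ∀ {m} → List (Fin m) → Fin m → ℕ
occurrences []       x = 0
occurrences (a ∷ as) x = indicator a x + occurrences as x

sumFin-occurrences : ∀ {m} (as : List (Fin m)) → sumFin (occurrences as) ≡ length as
sumFin-occurrences {m} []  = sumFin-zero {m} (λ _ → refl)
sumFin-occurrences (a ∷ as) =
  trans (sumFin-+ (indicator a) (occurrences as))
        (cong₂ _+_ (sumFin-indicator a) (sumFin-occurrences as))

occurrences-∉ : ∀ {m} {a : Fin m} {as} → All (a ≢_) as → occurrences as a ≡ 0
occurrences-∉ []                      = refl
occurrences-∉ {a = a} (_∷_ {b} a≢b a∉) = cong₂ _+_ (if-no (a ≟ b) a≢b 1) (occurrences-∉ a∉)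

occurrences-≤ : ∀ {m} {f : Fin m → ℕ} {as} →
                Unique as → All (λ a → 1 ≤ f a) as → ∀ x → occurrences as x ≤ f x
occurrences-≤ []              []              x = z≤n
occurrences-≤ (_∷_ {a} a∉ u) (1≤fa ∷ 1≤f) x with x ≟ a
... | yes refl rewrite occurrences-∉ a∉ = 1≤fa
... | no _     = occurrences-≤ u 1≤f x

length≤sumFin : ∀ {m} {f : Fin m → ℕ} {as} →
                Unique as → All (λ a → 1 ≤ f a) as → length as ≤ sumFin f
length≤sumFin {as = as} u 1≤f =
  subst (_≤ _) (sumFin-occurrences as) (sumFin-mono (occurrences-≤ u 1≤f))

module Image {m k : ℕ} (e : Fin m → Fin k) (e-inj : Injective _≡_ _≡_ e) where

  InImage : Fin k → Set
  InImage x = ∃[ i ] x ≡ e i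

  inImage? : ∀ x → Dec (InImage x)
  inImage? x = any? (λ i → x ≟ e i)

  image-indicator-sum : ∀ (f : Fin k → ℕ) x → (if does (inImage? x) then f x else 0)
                                      ≡ sumFin (λ i → if does (x ≟ e i) then f x else 0)
  image-indicator-sum f x with inImage? x
  ... | yes (j , x≡ej) = sym (trans (sumFin-single j λ i i≢j →
                                       if-no (x ≟ e i) (λ x≡ei → i≢j (e-inj (trans (sym x≡ei) x≡ej))) (f x))
                                    (if-yes (x ≟ e j) x≡ej (f x)))
  ... | no ¬im = sym (sumFin-zero λ i → if-no (x ≟ e i) (λ x≡ei → ¬im (i , x≡ei)) (f x))

  sumFin-split-image : ∀ (f : Fin k → ℕ) →
    sumFin f ≡ sumFin (λ x → if does (inImage? x) then 0 else f x) + sumFin (f ∘ e)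
  sumFin-split-image f = begin
    sumFin f
      ≡⟨ sumFin-cong split ⟩
    sumFin (λ x → outside x + inside x)
      ≡⟨ sumFin-+ outside inside ⟩
    sumFin outside + sumFin inside
      ≡⟨ cong (sumFin outside +_) (trans (sumFin-cong (image-indicator-sum f)) (sumFin-comm at)) ⟩
    sumFin outside + sumFin (λ i → sumFin (λ x → at x i))
      ≡⟨ cong (sumFin outside +_) (sumFin-cong at-single) ⟩
    sumFin outside + sumFin (f ∘ e) ∎
    where
    open ≡-Reasoning
    outside inside : Fin k → ℕ
    outside x = if does (inImage? x) then 0 else f x
    inside  x = if does (inImage? x) then f x else 0

    at : Fin k → Fin m → ℕ
    at x i = if does (x ≟ e i) then f x else 0

    split : ∀ x → f x ≡ outside x + inside x
    split x with inImage? x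
    ... | yes _ = refl
    ... | no _  = sym (+-identityʳ (f x))

    at-single : ∀ i → sumFin (λ x → at x i) ≡ f (e i)
    at-single i = trans (sumFin-single (e i) λ x x≢ei → if-no (x ≟ e i) x≢ei (f x))
                        (if-yes (e i ≟ e i) refl (f (e i)))

  override : {A : Set} → (Fin m → A) → (Fin k → A) → Fin k → A
  override g q x with inImage? x
  ... | yes (i , _) = g i
  ... | no _        = q x

  override-image : {A : Set} (g : Fin m → A) (q : Fin k → A) → ∀ i → override g q (e i) ≡ g i
  override-image g q i with inImage? (e i)
  ... | yes (j , ei≡ej) = cong g (sym (e-inj ei≡ej))
  ... | no ¬im          = ⊥-elim (¬im (i , refl))

  override-outside : {A : Set} (g : Fin m → A) (q : Fin k → A) → ∀ {x} → ¬ InImage x →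
                     override g q x ≡ q x
  override-outside g q {x} ¬im with inImage? x
  ... | yes im = ⊥-elim (¬im im)
  ... | no _   = refl

-- Graphs, star maps and star factors

module _ (G : Graph) where

  private
    V : Set
    V = Fin (n G)

  adj-sym : ∀ {u v} → adj G u v ≡ true → adj G v u ≡ true
  adj-sym {u} {v} uv = trans (Graph.sym G v u) uv

  adj⇒≢ : ∀ {u v} → adj G u v ≡ true → u ≢ v
  adj⇒≢ {u} uv refl with () ← trans (sym uv) (irrefl G u)

  length≤deg : ∀ {v} {as : List V} → Unique as → All (λ a → adj G v a ≡ true) as →
               length as ≤ deg G v
  length≤deg {v} u adjs = length≤sumFin u (All.map 1≤ adjs)
    where
    1≤ : ∀ {a} → adj G v a ≡ true → 1 ≤ (if adj G v a then 1 else 0)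
    1≤ va rewrite va = s≤s z≤n

-- A star map p sends each vertex of D to the centre of its star, so the centres are
-- exactly the fixed points of p.
record IsStarMapOn (G : Graph) (D : Fin (n G) → Set) (p : Fin (n G) → Fin (n G)) : Set where
  field
    closed      : ∀ x → D x → D (p x)
    idem        : ∀ x → D x → p (p x) ≡ p x
    adj-centre  : ∀ x → D x → p x ≢ x → adj G x (p x) ≡ true
    centre-leaf : ∀ x → D x → p x ≡ x → ∃[ y ] (D y × y ≢ x × p y ≡ x)

IsStarMap : (G : Graph) → (Fin (n G) → Fin (n G)) → Set
IsStarMap G = IsStarMapOn G (λ _ → ⊤)

centreEdgeWeight : {G : Graph} → EdgeWeighting G → (Fin (n G) → Fin (n G)) → Fin (n G) → ℕ
centreEdgeWeight ω p x = if does (p x ≟ x) then 0 else w ω x (p x)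

module StarFactor {G : Graph} {p : Fin (n G) → Fin (n G)} (S : IsStarMap G p) where

  open IsStarMapOn S

  private
    V : Set
    V = Fin (n G)

  StarEdge : V → V → Set
  StarEdge u v = u ≢ v × (p u ≡ v ⊎ p v ≡ u)

  starEdge? : ∀ u v → Dec (StarEdge u v)
  starEdge? u v = ¬? (u ≟ v) ×-dec (p u ≟ v ⊎-dec p v ≟ u)

  StarEdge-sym : ∀ {u v} → StarEdge u v → StarEdge v u
  StarEdge-sym (u≢v , inj₁ pu≡v) = (λ v≡u → u≢v (sym v≡u)) , inj₂ pu≡v
  StarEdge-sym (u≢v , inj₂ pv≡u) = (λ v≡u → u≢v (sym v≡u)) , inj₁ pv≡u

  StarEdge⇒adj : ∀ {u v} → StarEdge u v → adj G u v ≡ true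
  StarEdge⇒adj {u} (u≢v , inj₁ refl) = adj-centre u tt (λ pu≡u → u≢v (sym pu≡u))
  StarEdge⇒adj {v = v} (u≢v , inj₂ refl) = adj-sym G (adj-centre v tt u≢v)

  starFactor : SpanningSubgraph G
  starFactor = record
    { E    = λ u v → does (starEdge? u v)
    ; Esym = λ u v → does-⇔ (mk⇔ StarEdge-sym StarEdge-sym) (starEdge? u v) (starEdge? v u)
    ; E⊆G  = λ u v uv → StarEdge⇒adj (does-true (starEdge? u v) uv)
    }

  reach-centre : ∀ {v x} → Reach starFactor v x → p x ≡ p v
  reach-centre here = refl
  reach-centre (step {u} {w} uw w↝x) with does-true (starEdge? u w) uw
  ... | _ , inj₁ refl = trans (reach-centre w↝x) (idem u tt)
  ... | _ , inj₂ refl = trans (reach-centre w↝x) (sym (idem w tt))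

  edge-to-centre : ∀ x → p x ≢ x → E starFactor x (p x) ≡ true
  edge-to-centre x px≢x = dec-true (starEdge? x (p x)) ((λ x≡px → px≢x (sym x≡px)) , inj₁ refl)

  starFactor-isStarFactor : IsStarFactor starFactor
  starFactor-isStarFactor v = p v , v↝centre , other , edges-at-centre
    where
    v↝centre : Reach starFactor v (p v)
    v↝centre with p v ≟ v
    ... | yes pv≡v = subst (Reach starFactor v) (sym pv≡v) here
    ... | no  pv≢v = step (edge-to-centre v pv≢v) here

    other : ∃[ u ] (Reach starFactor v u × u ≢ p v)
    other with p v ≟ v
    ... | no  pv≢v = v , here , λ v≡pv → pv≢v (sym v≡pv)
    ... | yes pv≡v with centre-leaf v tt pv≡v
    ...   | y , _ , y≢v , refl =
            y , step (trans (Esym starFactor (p y) y) (edge-to-centre y (y≢v ∘ sym))) here ,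
            λ y≡pv → y≢v (trans y≡pv pv≡v)

    edges-at-centre : ∀ x y → Reach starFactor v x → E starFactor x y ≡ true → x ≡ p v ⊎ y ≡ p v
    edges-at-centre x y v↝x xy with does-true (starEdge? x y) xy
    ... | _ , inj₁ refl = inj₂ (reach-centre v↝x)
    ... | _ , inj₂ refl = inj₁ (trans (sym (idem y tt)) (reach-centre v↝x))

  module _ (ω : EdgeWeighting G) where

    private
      lt? : (u v : V) → Dec (toℕ u < toℕ v)
      lt? u v = toℕ u <? toℕ v

      -- the two ways u < v can be an edge of the star factor: v is the centre of u, or vice versa
      centreAbove centreBelow : V → V → ℕ
      centreAbove u v = if does (p u ≟ v ×-dec lt? u v) then w ω u v else 0
      centreBelow u v = if does (p v ≟ u ×-dec lt? u v) then w ω u v else 0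

      centreAboveWeight centreBelowWeight : V → ℕ
      centreAboveWeight u = if does (lt? u (p u)) then w ω u (p u) else 0
      centreBelowWeight u = if does (lt? (p u) u) then w ω (p u) u else 0

    edgeTerm-split : ∀ (u v : V) → (if does (starEdge? u v) ∧ does (lt? u v) then w ω u v else 0)
                           ≡ centreAbove u v + centreBelow u v
    edgeTerm-split u v =
      trans (cong (λ b → if b then w ω u v else 0)
                  (does-⇔ (mk⇔ distrib undistrib) (starEdge? u v ×-dec lt? u v)
                          ((p u ≟ v ×-dec lt? u v) ⊎-dec (p v ≟ u ×-dec lt? u v))))
            (if-⊎-dec (p u ≟ v ×-dec lt? u v) (p v ≟ u ×-dec lt? u v) not-both (w ω u v))
      where
      distrib : StarEdge u v × toℕ u < toℕ v → (p u ≡ v × toℕ u < toℕ v) ⊎ (p v ≡ u × toℕ u < toℕ v)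
      distrib ((_ , inj₁ pu≡v) , u<v) = inj₁ (pu≡v , u<v)
      distrib ((_ , inj₂ pv≡u) , u<v) = inj₂ (pv≡u , u<v)

      undistrib : (p u ≡ v × toℕ u < toℕ v) ⊎ (p v ≡ u × toℕ u < toℕ v) → StarEdge u v × toℕ u < toℕ v
      undistrib (inj₁ (pu≡v , u<v)) = ((λ { refl → <-irrefl refl u<v }) , inj₁ pu≡v) , u<v
      undistrib (inj₂ (pv≡u , u<v)) = ((λ { refl → <-irrefl refl u<v }) , inj₂ pv≡u) , u<v

      not-both : ¬ ((p u ≡ v × toℕ u < toℕ v) × (p v ≡ u × toℕ u < toℕ v))
      not-both ((refl , u<v) , ppu≡u , _) = <-irrefl (cong toℕ (trans (sym ppu≡u) (idem u tt))) u<v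

    sum-centreAbove : ∀ (u : V) → sumFin (centreAbove u) ≡ centreAboveWeight u
    sum-centreAbove u =
      trans (sumFin-single (p u) λ v v≢pu →
               cong (λ b → if b ∧ does (lt? u v) then w ω u v else 0) (dec-false (p u ≟ v) (v≢pu ∘ sym)))
            (cong (λ b → if b ∧ does (lt? u (p u)) then w ω u (p u) else 0) (dec-true (p u ≟ p u) refl))

    sum-centreBelow : ∀ (v : V) → sumFin (λ u → centreBelow u v) ≡ centreBelowWeight v
    sum-centreBelow v =
      trans (sumFin-single (p v) λ u u≢pv →
               cong (λ b → if b ∧ does (lt? u v) then w ω u v else 0) (dec-false (p v ≟ u) (u≢pv ∘ sym)))
            (cong (λ b → if b ∧ does (lt? (p v) v) then w ω (p v) v else 0) (dec-true (p v ≟ p v) refl))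

    centreAbove+BelowWeight : ∀ (u : V) → centreAboveWeight u + centreBelowWeight u ≡ centreEdgeWeight ω p u
    centreAbove+BelowWeight u with p u ≟ u
    ... | yes pu≡u = cong₂ _+_ (if-no (lt? u (p u)) (<-irrefl (cong toℕ (sym pu≡u))) _)
                               (if-no (lt? (p u) u) (<-irrefl (cong toℕ pu≡u)) _)
    ... | no pu≢u with <-cmp (toℕ u) (toℕ (p u))
    ...   | tri< u<pu _ pu≮u =
            trans (cong₂ _+_ (if-yes (lt? u (p u)) u<pu _) (if-no (lt? (p u) u) pu≮u _)) (+-identityʳ _)
    ...   | tri≈ _ u≡pu _ = ⊥-elim (pu≢u (sym (toℕ-injective u≡pu)))
    ...   | tri> u≮pu _ pu<u =
            trans (cong₂ _+_ (if-no (lt? u (p u)) u≮pu _) (if-yes (lt? (p u) u) pu<u _)) (wsym ω (p u) u)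

    weight-starFactor : weight ω starFactor ≡ sumFin (centreEdgeWeight ω p)
    weight-starFactor = begin
      weight ω starFactor
        ≡⟨ sumFin-cong (λ u → trans (sumFin-cong (edgeTerm-split u)) (sumFin-+ (centreAbove u) (centreBelow u))) ⟩
      sumFin (λ u → sumFin (centreAbove u) + sumFin (λ v → centreBelow u v))
        ≡⟨ sumFin-+ (λ u → sumFin (centreAbove u)) (λ u → sumFin (centreBelow u)) ⟩
      sumFin (λ u → sumFin (centreAbove u)) + sumFin (λ u → sumFin (λ v → centreBelow u v))
        ≡⟨ cong₂ _+_ (sumFin-cong sum-centreAbove) (trans (sumFin-comm centreBelow) (sumFin-cong sum-centreBelow)) ⟩
      sumFin centreAboveWeight + sumFin centreBelowWeight
        ≡⟨ sym (sumFin-+ centreAboveWeight centreBelowWeight) ⟩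
      sumFin (λ u → centreAboveWeight u + centreBelowWeight u)
        ≡⟨ sumFin-cong centreAbove+BelowWeight ⟩
      sumFin (centreEdgeWeight ω p) ∎
      where open ≡-Reasoning

-- Star maps of graphs without isolated vertices

infixl 5 _[_≔_]
_[_≔_] : ∀ {m} {A : Set} → (Fin m → A) → Fin m → A → Fin m → A
f [ a ≔ b ] = updateAt f a (const b)

module GreedyStarMap (G : Graph) (D : Fin (n G) → Set) (D? : ∀ x → Dec (D x))
  (D-neighbour : ∀ v → D v → ∃[ u ] (adj G v u ≡ true × D u)) where

  private
    V : Set
    V = Fin (n G)

  Covered : (V → Bool) → V → Set
  Covered A x = A x ≡ true

  record PartialStarMap (A : V → Bool) (p : V → V) : Set where
    field
      starMap   : IsStarMapOn G (Covered A) p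
      covered⇒D : ∀ x → Covered A x → D x
      fixed     : ∀ x → A x ≡ false → p x ≡ x

    open IsStarMapOn starMap public

    moved⇒covered : ∀ x → p x ≢ x → Covered A x
    moved⇒covered x px≢x with A x in Ax
    ... | true  = refl
    ... | false = ⊥-elim (px≢x (fixed x Ax))

    centre-uncovered : ∀ {v} x → A v ≡ false → p x ≡ v → x ≡ v
    centre-uncovered x Av refl with A x in Ax
    ... | true  with () ← trans (sym Av) (closed x Ax)
    ... | false = sym (fixed x Ax)

    idem′ : ∀ x → p (p x) ≡ p x
    idem′ x with A x in Ax
    ... | true  = idem x Ax
    ... | false = cong p (fixed x Ax)

    adj-centre′ : ∀ x → p x ≢ x → adj G x (p x) ≡ true
    adj-centre′ x px≢x = adj-centre x (moved⇒covered x px≢x) px≢x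

  Grows : (V → Bool) → (V → Bool) → Set
  Grows A A′ = ∀ x → Covered A x → Covered A′ x

  grows-≔true : ∀ (A : V → Bool) a → Grows A (A [ a ≔ true ])
  grows-≔true A a x Ax with x ≟ a
  ... | yes refl = updateAt-updates a A
  ... | no x≢a   = trans (updateAt-minimal x a A x≢a) Ax

  covered≢uncovered : ∀ {A : V → Bool} {x y} → Covered A x → A y ≡ false → x ≢ y
  covered≢uncovered Ax Ay refl with () ← trans (sym Ax) Ay

  covered-before-update : ∀ (A : V → Bool) {a x} b → (A [ a ≔ b ]) x ≡ true → x ≢ a → Covered A x
  covered-before-update A {a} {x} b A′x x≢a = trans (sym (updateAt-minimal x a A x≢a)) A′x

  -- v joins the star of u, which is a centre or, if uncovered, becomes one.
  module Attach {A p} (P : PartialStarMap A p) {v u} (Av : A v ≡ false) (Dv : D v)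
                (vu : adj G v u ≡ true) (Du : D u) (pu≡u : p u ≡ u) where

    open PartialStarMap P

    A′ : V → Bool
    A′ = A [ v ≔ true ] [ u ≔ true ]

    p′ : V → V
    p′ = p [ v ≔ u ]

    u≢v : u ≢ v
    u≢v = adj⇒≢ G vu ∘ sym

    A′-grows : Grows A A′
    A′-grows x = grows-≔true _ u x ∘ grows-≔true A v x

    A′v : Covered A′ v
    A′v = grows-≔true _ u v (updateAt-updates v A)

    A′u : Covered A′ u
    A′u = updateAt-updates u _

    p′v : p′ v ≡ u
    p′v = updateAt-updates v p

    p′-other : ∀ {x} → x ≢ v → p′ x ≡ p x
    p′-other {x} = updateAt-minimal x v p

    p′u : p′ u ≡ u
    p′u = trans (p′-other u≢v) pu≡u

    covered-old : ∀ {x} → Covered A′ x → x ≢ v → x ≢ u → Covered A x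
    covered-old A′x x≢v x≢u = covered-before-update A true (covered-before-update _ true A′x x≢u) x≢v

    starMap′ : IsStarMapOn G (Covered A′) p′
    IsStarMapOn.closed starMap′ x A′x with x ≟ v | x ≟ u
    ... | yes refl | _        = subst (Covered A′) (sym p′v) A′u
    ... | no _     | yes refl = subst (Covered A′) (sym p′u) A′u
    ... | no x≢v   | no x≢u   =
      subst (Covered A′) (sym (p′-other x≢v)) (A′-grows _ (closed x (covered-old A′x x≢v x≢u)))
    IsStarMapOn.idem starMap′ x _ with x ≟ v
    ... | yes refl = trans (cong p′ p′v) (trans p′u (sym p′v))
    ... | no x≢v rewrite p′-other x≢v = trans (p′-other (x≢v ∘ centre-uncovered x Av)) (idem′ x)
    IsStarMapOn.adj-centre starMap′ x _ p′x≢x with x ≟ v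
    ... | yes refl = subst (λ y → adj G v y ≡ true) (sym p′v) vu
    ... | no x≢v rewrite p′-other x≢v = adj-centre′ x p′x≢x
    IsStarMapOn.centre-leaf starMap′ x A′x p′x≡x with x ≟ v | x ≟ u
    ... | yes refl | _        = ⊥-elim (u≢v (trans (sym p′v) p′x≡x))
    ... | no _     | yes refl = v , A′v , u≢v ∘ sym , p′v
    ... | no x≢v   | no x≢u
          with centre-leaf x (covered-old A′x x≢v x≢u) (trans (sym (p′-other x≢v)) p′x≡x)
    ...   | y , Ay , y≢x , py≡x =
            y , A′-grows y Ay , y≢x , trans (p′-other (covered≢uncovered Ay Av)) py≡x

    partial′ : PartialStarMap A′ p′
    PartialStarMap.starMap partial′ = starMap′
    PartialStarMap.covered⇒D partial′ x A′x with x ≟ v | x ≟ u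
    ... | yes refl | _        = Dv
    ... | no _     | yes refl = Du
    ... | no x≢v   | no x≢u   = covered⇒D x (covered-old A′x x≢v x≢u)
    PartialStarMap.fixed partial′ x A′x≡false =
      trans (p′-other x≢v) (fixed x (trans (sym (updateAt-minimal x v A x≢v))
                                           (trans (sym (updateAt-minimal x u _ x≢u)) A′x≡false)))
      where
      x≢v : x ≢ v
      x≢v = covered≢uncovered A′v A′x≡false ∘ sym
      x≢u : x ≢ u
      x≢u = covered≢uncovered A′u A′x≡false ∘ sym

  -- u leaves the star of its centre c and becomes the centre of a new star containing v;
  -- if u was the only leaf of c, then c joins the new star as well.
  module Steal {A p} (P : PartialStarMap A p) {v u} (Av : A v ≡ false) (Dv : D v)
               (vu : adj G v u ≡ true) (pu≢u : p u ≢ u) where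

    open PartialStarMap P

    c : V
    c = p u

    Au : Covered A u
    Au = moved⇒covered u pu≢u

    Ac : Covered A c
    Ac = closed u Au

    u≢v : u ≢ v
    u≢v = covered≢uncovered Au Av

    c≢v : c ≢ v
    c≢v = covered≢uncovered Ac Av

    u≢c : u ≢ c
    u≢c = pu≢u ∘ sym

    OtherLeaf : Set
    OtherLeaf = ∃[ y ] (y ≢ u × y ≢ c × p y ≡ c)

    otherLeaf? : Dec OtherLeaf
    otherLeaf? = any? λ y → ¬? (y ≟ u) ×-dec ¬? (y ≟ c) ×-dec (p y ≟ c)

    newCentre : Dec OtherLeaf → V
    newCentre (yes _) = c
    newCentre (no _)  = u

    r : V
    r = newCentre otherLeaf?

    r-cases : (r ≡ c × OtherLeaf) ⊎ r ≡ u
    r-cases with otherLeaf?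
    ... | yes other = inj₁ (refl , other)
    ... | no _      = inj₂ refl

    other⇒r≡c : OtherLeaf → r ≡ c
    other⇒r≡c other with otherLeaf?
    ... | yes _      = refl
    ... | no ¬other  = ⊥-elim (¬other other)

    r≡c⇒other : r ≡ c → OtherLeaf
    r≡c⇒other r≡c with r-cases
    ... | inj₁ (_ , other) = other
    ... | inj₂ r≡u         = ⊥-elim (u≢c (trans (sym r≡u) r≡c))

    A′ : V → Bool
    A′ = A [ v ≔ true ]

    p′ : V → V
    p′ = p [ c ≔ r ] [ u ≔ u ] [ v ≔ u ]

    A′-grows : Grows A A′
    A′-grows = grows-≔true A v

    A′v : Covered A′ v
    A′v = updateAt-updates v A

    covered-old : ∀ {x} → Covered A′ x → x ≢ v → Covered A x
    covered-old = covered-before-update A true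

    p′v : p′ v ≡ u
    p′v = updateAt-updates v _

    p′u : p′ u ≡ u
    p′u = trans (updateAt-minimal u v _ u≢v) (updateAt-updates u _)

    p′c : p′ c ≡ r
    p′c = trans (updateAt-minimal c v _ c≢v) (trans (updateAt-minimal c u _ (u≢c ∘ sym))
                                                    (updateAt-updates c p))

    p′-other : ∀ {x} → x ≢ v → x ≢ u → x ≢ c → p′ x ≡ p x
    p′-other {x} x≢v x≢u x≢c =
      trans (updateAt-minimal x v _ x≢v) (trans (updateAt-minimal x u _ x≢u) (updateAt-minimal x c p x≢c))

    p′r : p′ r ≡ r
    p′r with r-cases
    ... | inj₁ (r≡c , _) = trans (cong p′ r≡c) p′c
    ... | inj₂ r≡u       = trans (cong p′ r≡u) (trans p′u (sym r≡u))

    Ar : Covered A r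
    Ar with r-cases
    ... | inj₁ (r≡c , _) = subst (Covered A) (sym r≡c) Ac
    ... | inj₂ r≡u       = subst (Covered A) (sym r≡u) Au

    data Position (x : V) : Set where
      at-v      : x ≡ v → Position x
      at-u      : x ≡ u → Position x
      at-c      : x ≡ c → Position x
      elsewhere : x ≢ v → x ≢ u → x ≢ c → Position x

    position : ∀ x → Position x
    position x with x ≟ v | x ≟ u | x ≟ c
    ... | yes x≡v | _       | _       = at-v x≡v
    ... | no _    | yes x≡u | _       = at-u x≡u
    ... | no _    | no _    | yes x≡c = at-c x≡c
    ... | no x≢v  | no x≢u  | no x≢c  = elsewhere x≢v x≢u x≢c

    centre-covered : ∀ {x y} → p′ x ≡ y → Covered A y → Covered A′ (p′ x)
    centre-covered p′x≡y Ay = subst (Covered A′) (sym p′x≡y) (A′-grows _ Ay)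

    p′-closed : ∀ x → Covered A′ x → Covered A′ (p′ x)
    p′-closed x A′x with position x
    ... | at-v refl = centre-covered p′v Au
    ... | at-u refl = centre-covered p′u Au
    ... | at-c refl = centre-covered p′c Ar
    ... | elsewhere x≢v x≢u x≢c = centre-covered (p′-other x≢v x≢u x≢c) (closed x (covered-old A′x x≢v))

    p′-idem : ∀ x → p′ (p′ x) ≡ p′ x
    p′-idem x with position x
    ... | at-v refl = trans (cong p′ p′v) (trans p′u (sym p′v))
    ... | at-u refl = cong p′ p′u
    ... | at-c refl = trans (cong p′ p′c) (trans p′r (sym p′c))
    ... | elsewhere x≢v x≢u x≢c rewrite p′-other x≢v x≢u x≢c with p x ≟ c
    ...   | yes px≡c = trans (cong p′ px≡c) (trans p′c (trans (other⇒r≡c (x , x≢u , x≢c , px≡c)) (sym px≡c)))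
    ...   | no px≢c  = trans (p′-other (x≢v ∘ centre-uncovered x Av) px≢u px≢c) (idem′ x)
      where
      px≢u : p x ≢ u
      px≢u px≡u = pu≢u (trans (cong p (sym px≡u)) (trans (idem′ x) px≡u))

    p′-adj-centre : ∀ x → p′ x ≢ x → adj G x (p′ x) ≡ true
    p′-adj-centre x p′x≢x with position x
    ... | at-v refl = subst (λ y → adj G v y ≡ true) (sym p′v) vu
    ... | at-u refl = ⊥-elim (p′x≢x p′u)
    ... | at-c refl with r-cases
    ...   | inj₁ (r≡c , _) = ⊥-elim (p′x≢x (trans p′c r≡c))
    ...   | inj₂ r≡u = subst (λ y → adj G c y ≡ true) (sym (trans p′c r≡u)) (adj-sym G (adj-centre′ u pu≢u))
    p′-adj-centre x p′x≢x | elsewhere x≢v x≢u x≢c rewrite p′-other x≢v x≢u x≢c = adj-centre′ x p′x≢x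

    p′-centre-leaf : ∀ x → Covered A′ x → p′ x ≡ x → ∃[ y ] (Covered A′ y × y ≢ x × p′ y ≡ x)
    p′-centre-leaf x A′x p′x≡x with position x
    ... | at-v refl = ⊥-elim (u≢v (trans (sym p′v) p′x≡x))
    ... | at-u refl = v , A′v , u≢v ∘ sym , p′v
    ... | at-c refl with r≡c⇒other (trans (sym p′c) p′x≡x)
    ...   | y , y≢u , y≢c , py≡c =
            y , A′-grows y Ay , y≢c , trans (p′-other (covered≢uncovered Ay Av) y≢u y≢c) py≡c
      where
      Ay : Covered A y
      Ay = moved⇒covered y (λ py≡y → y≢c (trans (sym py≡y) py≡c))
    p′-centre-leaf x A′x p′x≡x | elsewhere x≢v x≢u x≢c
      with centre-leaf x (covered-old A′x x≢v) (trans (sym (p′-other x≢v x≢u x≢c)) p′x≡x)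
    ... | y , Ay , y≢x , py≡x =
          y , A′-grows y Ay , y≢x , trans (p′-other (covered≢uncovered Ay Av) y≢u y≢c) py≡x
      where
      y≢u : y ≢ u
      y≢u y≡u = x≢c (trans (sym py≡x) (cong p y≡u))
      y≢c : y ≢ c
      y≢c y≡c = x≢c (trans (sym py≡x) (trans (cong p y≡c) (idem u Au)))

    partial′ : PartialStarMap A′ p′
    PartialStarMap.starMap partial′ = record
      { closed = p′-closed ; idem = λ x _ → p′-idem x ; adj-centre = λ x _ → p′-adj-centre x
      ; centre-leaf = p′-centre-leaf }
    PartialStarMap.covered⇒D partial′ x A′x with x ≟ v
    ... | yes refl = Dv
    ... | no x≢v   = covered⇒D x (covered-old A′x x≢v)
    PartialStarMap.fixed partial′ x A′x≡false =
      trans (p′-other x≢v (covered≢uncovered Au Ax≡false ∘ sym) (covered≢uncovered Ac Ax≡false ∘ sym))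
            (fixed x Ax≡false)
      where
      x≢v : x ≢ v
      x≢v = covered≢uncovered A′v A′x≡false ∘ sym
      Ax≡false : A x ≡ false
      Ax≡false = trans (sym (updateAt-minimal x v A x≢v)) A′x≡false

  State : Set
  State = Σ (V → Bool) λ A → Σ (V → V) (PartialStarMap A)

  coveredBy : State → V → Bool
  coveredBy (A , _) = A

  empty : State
  empty = (λ _ → false) , (λ x → x) , record
    { starMap   = record { closed = λ _ () ; idem = λ _ () ; adj-centre = λ _ () ; centre-leaf = λ _ () }
    ; covered⇒D = λ _ ()
    ; fixed     = λ _ _ → refl
    }

  cover : (s : State) → ∀ v →
          ∃[ s′ ] (Grows (coveredBy s) (coveredBy s′) × (D v → Covered (coveredBy s′) v))
  cover (A , p , P) v with A v in Av | D? v
  ... | true  | _       = (A , p , P) , (λ _ Ax → Ax) , λ _ → Av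
  ... | false | no ¬Dv  = (A , p , P) , (λ _ Ax → Ax) , ⊥-elim ∘ ¬Dv
  ... | false | yes Dv with D-neighbour v Dv
  ...   | u , vu , Du with p u ≟ u
  ...     | yes pu≡u = (A′ , p′ , partial′) , A′-grows , λ _ → A′v
    where open Attach P Av Dv vu Du pu≡u
  ...     | no pu≢u  = (A′ , p′ , partial′) , A′-grows , λ _ → A′v
    where open Steal P Av Dv vu pu≢u

  cover-all : (s : State) → ∀ vs →
              ∃[ s′ ] (Grows (coveredBy s) (coveredBy s′) × (∀ {x} → x ∈ vs → D x → Covered (coveredBy s′) x))
  cover-all s []       = s , (λ _ Ax → Ax) , λ ()
  cover-all s (v ∷ vs) with cover s v
  ... | s₁ , s⊆s₁ , v∈s₁ with cover-all s₁ vs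
  ...   | s₂ , s₁⊆s₂ , vs⊆s₂ = s₂ , (λ x → s₁⊆s₂ x ∘ s⊆s₁ x) , λ
    { (here refl) Dv → s₁⊆s₂ _ (v∈s₁ Dv)
    ; (there x∈vs) Dx → vs⊆s₂ x∈vs Dx }

  starMapOn : ∃[ p ] IsStarMapOn G D p
  starMapOn with cover-all empty (allFin (n G))
  ... | (A , p , P) , _ , D⊆A = p , record
    { closed      = λ x Dx → covered⇒D (p x) (closed x (D⊆A′ Dx))
    ; idem        = λ x Dx → idem x (D⊆A′ Dx)
    ; adj-centre  = λ x Dx → adj-centre x (D⊆A′ Dx)
    ; centre-leaf = λ x Dx px≡x → leaf-in-D (centre-leaf x (D⊆A′ Dx) px≡x)
    }
    where
    open PartialStarMap P
    D⊆A′ : ∀ {x} → D x → Covered A x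
    D⊆A′ {x} = D⊆A (∈-allFin x)
    leaf-in-D : ∀ {x} → ∃[ y ] (Covered A y × y ≢ x × p y ≡ x) → ∃[ y ] (D y × y ≢ x × p y ≡ x)
    leaf-in-D (y , Ay , y≢x , py≡x) = y , covered⇒D y Ay , y≢x , py≡x

-- If ℓ is a pendant vertex with neighbour c, then either c is already a centre, or {ℓ, c}
-- is a star centred at ℓ whose centre can be moved to c.
module Recentre (G : Graph) {D : Fin (n G) → Set} {p} (S : IsStarMapOn G D p) {ℓ c : Fin (n G)}
  (Dℓ : D ℓ) (ℓc : adj G ℓ c ≡ true) (ℓ-pendant : ∀ z → adj G ℓ z ≡ true → z ≡ c) where

  open IsStarMapOn S

  private
    V : Set
    V = Fin (n G)

  module _ (pc≢c : p c ≢ c) where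

    pℓ≡ℓ : p ℓ ≡ ℓ
    pℓ≡ℓ with p ℓ ≟ ℓ
    ... | yes pℓ≡ℓ = pℓ≡ℓ
    ... | no pℓ≢ℓ  = ⊥-elim (pc≢c (trans (cong p (sym pℓ≡c)) (trans (idem ℓ Dℓ) pℓ≡c)))
      where
      pℓ≡c : p ℓ ≡ c
      pℓ≡c = ℓ-pendant (p ℓ) (adj-centre ℓ Dℓ pℓ≢ℓ)

    leaf-of-ℓ : ∀ x → D x → x ≢ ℓ → p x ≡ ℓ → x ≡ c
    leaf-of-ℓ x Dx x≢ℓ refl = ℓ-pendant x (adj-sym G (adj-centre x Dx (x≢ℓ ∘ sym)))

    Dc×pc≡ℓ : D c × p c ≡ ℓ
    Dc×pc≡ℓ with centre-leaf ℓ Dℓ pℓ≡ℓ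
    ... | y , Dy , y≢ℓ , py≡ℓ with leaf-of-ℓ y Dy y≢ℓ py≡ℓ
    ...   | refl = Dy , py≡ℓ

    q : V → V
    q x = if does (p x ≟ ℓ) then c else p x

    qc≡c : q c ≡ c
    qc≡c = cong (λ b → if b then c else p c) (dec-true (p c ≟ ℓ) (proj₂ Dc×pc≡ℓ))

    ℓ≢c : ℓ ≢ c
    ℓ≢c = adj⇒≢ G ℓc

    recentred : IsStarMapOn G D q
    IsStarMapOn.closed recentred x Dx with p x ≟ ℓ
    ... | yes _ = proj₁ Dc×pc≡ℓ
    ... | no _  = closed x Dx
    IsStarMapOn.idem recentred x Dx with p x ≟ ℓ
    ... | yes _    = qc≡c
    ... | no px≢ℓ  =
          trans (cong (λ b → if b then c else p (p x))
                      (dec-false (p (p x) ≟ ℓ) (px≢ℓ ∘ trans (sym (idem x Dx)))))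
                (idem x Dx)
    IsStarMapOn.adj-centre recentred x Dx qx≢x with p x ≟ ℓ
    ... | no _     = adj-centre x Dx qx≢x
    ... | yes px≡ℓ with x ≟ ℓ
    ...   | yes refl = ℓc
    ...   | no x≢ℓ   = ⊥-elim (qx≢x (sym (leaf-of-ℓ x Dx x≢ℓ px≡ℓ)))
    IsStarMapOn.centre-leaf recentred x Dx qx≡x with p x ≟ ℓ
    ... | yes _ rewrite sym qx≡x =
          ℓ , Dℓ , ℓ≢c , cong (λ b → if b then c else p ℓ) (dec-true (p ℓ ≟ ℓ) pℓ≡ℓ)
    ... | no px≢ℓ with centre-leaf x Dx qx≡x
    ...   | y , Dy , y≢x , py≡x =
            y , Dy , y≢x , trans (cong (λ b → if b then c else p y) (dec-false (p y ≟ ℓ) py≢ℓ)) py≡x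
      where
      py≢ℓ : p y ≢ ℓ
      py≢ℓ py≡ℓ = px≢ℓ (trans qx≡x (trans (sym py≡x) py≡ℓ))

  recentre : ∃[ q ] (IsStarMapOn G D q × q c ≡ c)
  recentre with p c ≟ c
  ... | yes pc≡c = p , S , pc≡c
  ... | no pc≢c  = q pc≢c , recentred pc≢c , qc≡c pc≢c

-- The induced six-cycle

-- A star map of the cycle 0-1-2-3-4-5-0 in which vertex 0 is a centre that needs no leaf
-- on the cycle: in G it keeps its leaf outside the cycle.
record IsArcStarMap (τ : Fin 6 → Fin 6) : Set where
  field
    fixes-0      : τ 0F ≡ 0F
    idem         : ∀ k → τ (τ k) ≡ τ k
    cycle-centre : ∀ k → τ k ≢ k → cycAdj6 k (τ k) ≡ true
    centre-leaf  : ∀ k → k ≢ 0F → τ k ≡ k → ∃[ j ] (j ≢ k × τ j ≡ k)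

isArcStarMap? : ∀ τ → Dec (IsArcStarMap τ)
isArcStarMap? τ = map′ (λ (f , i , a , l) → record { fixes-0 = f ; idem = i ; cycle-centre = a ; centre-leaf = l })
                       (λ R → let open IsArcStarMap R in fixes-0 , idem , cycle-centre , centre-leaf)
  (τ 0F ≟ 0F
   ×-dec all? (λ k → τ (τ k) ≟ τ k)
   ×-dec all? (λ k → ¬? (τ k ≟ k) →-dec cycAdj6 k (τ k) ≟ᵇ true)
   ×-dec all? (λ k → ¬? (k ≟ 0F) →-dec τ k ≟ k →-dec any? (λ j → ¬? (j ≟ k) ×-dec τ j ≟ k)))

prev6 : Fin 6 → Fin 6
prev6 = lookup (5F ∷ 0F ∷ 1F ∷ 2F ∷ 3F ∷ 4F ∷ [])

cycle-neighbours : ∀ k → next6 k ≢ prev6 k × cycAdj6 k (next6 k) ≡ true × cycAdj6 k (prev6 k) ≡ true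
cycle-neighbours 0F = (λ ()) , refl , refl
cycle-neighbours 1F = (λ ()) , refl , refl
cycle-neighbours 2F = (λ ()) , refl , refl
cycle-neighbours 3F = (λ ()) , refl , refl
cycle-neighbours 4F = (λ ()) , refl , refl
cycle-neighbours 5F = (λ ()) , refl , refl

module PendantC6 (G : Graph) (no-isolated : NoIsolated G)
  (c : Fin 6 → Fin (n G)) (c-inj : Injective _≡_ _≡_ c)
  (c-induced : ∀ i j → adj G (c i) (c j) ≡ cycAdj6 i j)
  (deg-c : ∀ i → i ≢ 0F → deg G (c i) ≡ 2)
  (ℓ : Fin (n G)) (c0ℓ : adj G (c 0F) ℓ ≡ true) (leaf-ℓ : IsLeaf G ℓ) where

  private
    V : Set
    V = Fin (n G)

  arc : Fin 5 → V
  arc = c ∘ suc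

  open Image arc (suc-injective ∘ c-inj) public

  OffArc : V → Set
  OffArc x = ¬ InImage x

  ℓ-pendant : ∀ z → adj G ℓ z ≡ true → z ≡ c 0F
  ℓ-pendant z ℓz with z ≟ c 0F
  ... | yes z≡c0 = z≡c0
  ... | no z≢c0 with subst (2 ≤_) leaf-ℓ (length≤deg G (((z≢c0 ∘ sym) ∷ []) ∷ [] ∷ []) (adj-sym G c0ℓ ∷ ℓz ∷ []))
  ...   | s≤s ()

  arc-neighbour : ∀ k {z} → k ≢ 0F → adj G (c k) z ≡ true → ∃[ j ] z ≡ c j
  arc-neighbour k {z} k≢0 kz with cycle-neighbours k
  ... | next≢prev , k-next , k-prev with z ≟ c (next6 k) | z ≟ c (prev6 k)
  ...   | yes z≡next | _          = next6 k , z≡next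
  ...   | no _       | yes z≡prev = prev6 k , z≡prev
  ...   | no z≢next  | no z≢prev
          with subst (3 ≤_) (deg-c k k≢0)
                 (length≤deg G (((next≢prev ∘ c-inj) ∷ (z≢next ∘ sym) ∷ []) ∷ ((z≢prev ∘ sym) ∷ []) ∷ [] ∷ [])
                               (trans (c-induced k _) k-next ∷ trans (c-induced k _) k-prev ∷ kz ∷ []))
  ...     | s≤s (s≤s ())

  OffArc-c0 : OffArc (c 0F)
  OffArc-c0 (i , c0≡arc) with () ← c-inj c0≡arc

  OffArc-ℓ : OffArc ℓ
  OffArc-ℓ (i , refl) with () ← trans (sym leaf-ℓ) (deg-c (suc i) λ ())

  OffArc-neighbour : ∀ v → OffArc v → ∃[ u ] (adj G v u ≡ true × OffArc u)
  OffArc-neighbour v OffArc-v with v ≟ c 0F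
  ... | yes refl = ℓ , c0ℓ , OffArc-ℓ
  ... | no v≢c0 with no-isolated v
  ...   | u , vu with inImage? u
  ...     | no OffArc-u = u , vu , OffArc-u
  ...     | yes (i , refl) with arc-neighbour (suc i) (λ ()) (adj-sym G vu)
  ...       | 0F    , v≡c0   = ⊥-elim (v≢c0 v≡c0)
  ...       | suc j , v≡arcj = ⊥-elim (OffArc-v (j , v≡arcj))

  offStarMap : ∃[ p ] (IsStarMapOn G OffArc p × p (c 0F) ≡ c 0F)
  offStarMap = Recentre.recentre G (proj₂ starMapOn) OffArc-ℓ (adj-sym G c0ℓ) ℓ-pendant
    where open GreedyStarMap G OffArc (¬? ∘ inImage?) OffArc-neighbour

  arc-or-off : ∀ x → (∃[ i ] x ≡ arc i) ⊎ OffArc x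
  arc-or-off x with inImage? x
  ... | yes on-arc = inj₁ on-arc
  ... | no off     = inj₂ off

  module Extension {p : V → V} (P : IsStarMapOn G OffArc p) (p-c0 : p (c 0F) ≡ c 0F)
                   {τ : Fin 6 → Fin 6} (R : IsArcStarMap τ) where

    module S = IsStarMapOn P
    open IsArcStarMap R renaming (idem to τ-idem; centre-leaf to τ-centre-leaf)

    q : V → V
    q = override (λ i → c (τ (suc i))) p

    q-cycle : ∀ k → q (c k) ≡ c (τ k)
    q-cycle 0F      = trans (override-outside _ p OffArc-c0) (trans p-c0 (cong c (sym fixes-0)))
    q-cycle (suc i) = override-image _ p i

    q-off : ∀ {x} → OffArc x → q x ≡ p x
    q-off = override-outside _ p

    isStarMap : IsStarMap G q
    IsStarMapOn.closed isStarMap _ _ = tt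
    IsStarMapOn.idem isStarMap x _ with arc-or-off x
    ... | inj₁ (i , refl) =
          trans (cong q (q-cycle (suc i)))
                (trans (q-cycle (τ (suc i))) (trans (cong c (τ-idem (suc i))) (sym (q-cycle (suc i)))))
    ... | inj₂ off rewrite q-off off = trans (q-off (S.closed x off)) (S.idem x off)
    IsStarMapOn.adj-centre isStarMap x _ qx≢x with arc-or-off x
    ... | inj₁ (i , refl) rewrite q-cycle (suc i) =
          trans (c-induced (suc i) (τ (suc i))) (cycle-centre (suc i) (qx≢x ∘ cong c))
    ... | inj₂ off rewrite q-off off = S.adj-centre x off qx≢x
    IsStarMapOn.centre-leaf isStarMap x _ qx≡x with arc-or-off x
    ... | inj₁ (i , refl) with τ-centre-leaf (suc i) (λ ()) (c-inj (trans (sym (q-cycle (suc i))) qx≡x))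
    ...   | j , j≢k , τj≡k = c j , tt , j≢k ∘ c-inj , trans (q-cycle j) (cong c τj≡k)
    IsStarMapOn.centre-leaf isStarMap x _ qx≡x | inj₂ off with S.centre-leaf x off (trans (sym (q-off off)) qx≡x)
    ... | y , off-y , y≢x , py≡x = y , tt , y≢x , trans (q-off off-y) py≡x

    open StarFactor isStarMap public using (starFactor; starFactor-isStarFactor; weight-starFactor)

  module _ (ω : EdgeWeighting G) where

    arcEdgeWeight : (Fin 6 → Fin 6) → Fin 6 → ℕ
    arcEdgeWeight τ k = if does (τ k ≟ k) then 0 else w ω (c k) (c (τ k))

    arcWeight : (Fin 6 → Fin 6) → ℕ
    arcWeight τ = sumFin (λ i → arcEdgeWeight τ (suc i))

    offWeight : (V → V) → ℕ
    offWeight p = sumFin (λ x → if does (inImage? x) then 0 else centreEdgeWeight ω p x)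

    weight-extension : ∀ {p} (P : IsStarMapOn G OffArc p) (p-c0 : p (c 0F) ≡ c 0F) {τ} (R : IsArcStarMap τ) →
                       weight ω (Extension.starFactor P p-c0 R) ≡ offWeight p + arcWeight τ
    weight-extension {p} P p-c0 {τ} R = begin
      weight ω starFactor
        ≡⟨ weight-starFactor ω ⟩
      sumFin (centreEdgeWeight ω q)
        ≡⟨ sumFin-split-image (centreEdgeWeight ω q) ⟩
      sumFin (λ x → if does (inImage? x) then 0 else centreEdgeWeight ω q x) + sumFin (centreEdgeWeight ω q ∘ arc)
        ≡⟨ cong₂ _+_ (sumFin-cong off-agrees) (sumFin-cong (arc-agrees ∘ suc)) ⟩
      offWeight p + arcWeight τ ∎
      where
      open ≡-Reasoning
      open Extension P p-c0 R

      off-agrees : ∀ x → (if does (inImage? x) then 0 else centreEdgeWeight ω q x)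
                       ≡ (if does (inImage? x) then 0 else centreEdgeWeight ω p x)
      off-agrees x = if-no-cong (inImage? x) λ off → cong (λ y → if does (y ≟ x) then 0 else w ω x y) (q-off off)

      arc-agrees : ∀ k → centreEdgeWeight ω q (c k) ≡ arcEdgeWeight τ k
      arc-agrees k =
        trans (cong (λ y → if does (y ≟ c k) then 0 else w ω (c k) y) (q-cycle k))
              (cong (λ b → if b then 0 else w ω (c k) (c (τ k)))
                    (does-⇔ (mk⇔ c-inj (cong c)) (c (τ k) ≟ c k) (τ k ≟ k)))

    arcWeight-balanced : (∀ F₁ F₂ → IsStarFactor F₁ → IsStarFactor F₂ → weight ω F₁ ≡ weight ω F₂) →
                         ∀ {τ τ′} → IsArcStarMap τ → IsArcStarMap τ′ → arcWeight τ ≡ arcWeight τ′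
    arcWeight-balanced balanced R R′ with offStarMap
    ... | p , P , p-c0 =
      +-cancelˡ-≡ (offWeight p) _ _
        (trans (sym (weight-extension P p-c0 R))
               (trans (balanced _ _ (Extension.starFactor-isStarFactor P p-c0 R)
                                    (Extension.starFactor-isStarFactor P p-c0 R′))
                      (weight-extension P p-c0 R′)))

-- Arc stars, centre first.  τ₁: 01 32 54,  τ₂: 015 324,  τ₃: 05 21 43,  τ₄: 21 435.
τ₁ τ₂ τ₃ τ₄ : Fin 6 → Fin 6
τ₁ = lookup (0F ∷ 0F ∷ 3F ∷ 3F ∷ 5F ∷ 5F ∷ [])
τ₂ = lookup (0F ∷ 0F ∷ 3F ∷ 3F ∷ 3F ∷ 0F ∷ [])
τ₃ = lookup (0F ∷ 2F ∷ 2F ∷ 4F ∷ 4F ∷ 0F ∷ [])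
τ₄ = lookup (0F ∷ 2F ∷ 2F ∷ 4F ∷ 4F ∷ 4F ∷ [])

cancel-prefix : ∀ a b {m m′} → a + (b + m) ≡ a + (b + m′) → m ≡ m′
cancel-prefix a b = +-cancelˡ-≡ b _ _ ∘ +-cancelˡ-≡ a _ _

lemma2p6 : (G : Graph) → NoIsolated G →
    (∃[ c ] (IsInducedC6 G c × (∀ (i : Fin 6) → i ≢ zero → deg G (c i) ≡ 2) × IsStem G (c zero))) →
    ¬ InΩ G
lemma2p6 G no-isolated (c , (c-inj , c-induced) , deg-c , ℓ , c0ℓ , leaf-ℓ) (ω , balanced) =
  <⇒≢ (wpos ω (c 4F) (c 3F) (c-induced 4F 3F)) (sym w₄₃≡0)
  where
  open PendantC6 G no-isolated c c-inj c-induced deg-c ℓ c0ℓ leaf-ℓ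

  w′ : Fin 6 → Fin 6 → ℕ
  w′ i j = w ω (c i) (c j)

  τ₁≈τ₂ : w′ 4F 5F + 0 ≡ w′ 4F 3F + (w′ 5F 0F + 0)
  τ₁≈τ₂ = cancel-prefix (w′ 1F 0F) (w′ 2F 3F)
            (arcWeight-balanced ω balanced (from-yes (isArcStarMap? τ₁)) (from-yes (isArcStarMap? τ₂)))

  τ₃≈τ₄ : w′ 5F 0F + 0 ≡ w′ 5F 4F + 0
  τ₃≈τ₄ = cancel-prefix (w′ 1F 2F) (w′ 3F 4F)
            (arcWeight-balanced ω balanced (from-yes (isArcStarMap? τ₃)) (from-yes (isArcStarMap? τ₄)))

  w₄₃≡0 : w′ 4F 3F ≡ 0
  w₄₃≡0 = +-cancelʳ-≡ _ _ 0 (trans (sym τ₁≈τ₂) (trans (cong (_+ 0) (wsym ω (c 4F) (c 5F))) (sym τ₃≈τ₄)))
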